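{- Let $r\in\mathbb{N}$ and let $((G, \mathcal{D}, k), M)$ be an $r$-stripped context. Then the instances $(G, \mathcal{D}, k)$ and $(G[M], \mathcal{D}, k)$ of Ann.-$K_r$-Cover are equivalent (one is positive if and only if the other is).
   Context: For a graph $G$, an $i$-clique is a set of $i$ vertices inducing a complete graph; $\mathcal{K}_r(G)$ denotes the set of $r$-cliques of $G$ and $\mathcal{K}_{<r}(G)$ the set of cliques of $G$ with fewer than $r$ vertices. For a collection of sets $\mathcal{D}$, $V(\mathcal{D})=\bigcup_{D\in\mathcal{D}}D$. In Ann.-$K_r$-Cover, an instance is a triple $(G,\mathcal{D},k)$ with $G$ a graph, $\mathcal{D}\subseteq\mathcal{K}_{<r}(G)$ and $k$ an integer; a solution is a set of at most $k$ vertices that intersects every set in $\mathcal{K}_r(G)$ and every set in $\mathcal{D}$; the instance is positive if it has a solution. A $K_r$-cover of $G$ is a set $M\subseteq V(G)$ such that $G-M$ has no $r$-clique. A context is a pair $((G,\mathcal{D},k),M)$ where $(G,\mathcal{D},k)$ is an instance of Ann.-$K_r$-Cover, $M$ is a $K_r$-cover of $G$ (of any size), and $V(\mathcal{D})\subseteq M$. For an $i$-clique $X$ ($1\le i\le r-1$), an $r$-petal of $X$ is a set $Y\subseteq V(G)\setminus X$ such that $X\cup Y$ is an $r$-clique. Given a context $((G,\mathcal{D},k),M)$ and $i\in\{1,\dots,r-1\}$, a lush $i$-clique is an $i$-clique $X$ of $G[M]$ that has an $r$-petal contained in $V(G)\setminus M$ and such that no $D\in\mathcal{D}$ is a subset of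 $X$. The context is $i$-stripped if for every $i'<i$ it has no lush $i'$-clique. -}

module Defs where

open import Data.Nat using (ℕ; _<_; _≤_)
open import Data.Integer using (ℤ; +_) renaming (_≤_ to _≤ℤ_)
open import Data.Fin using (Fin)
open import Data.Fin.Subset using (Subset; _∈_; _∉_; _⊆_; _∩_; _∪_; ∁; ∣_∣)
open import Data.List using (List)
open import Data.List.Relation.Unary.Any using (Any)
open import Data.List.Relation.Unary.All using (All)
open import Data.Product using (Σ; _×_; ∃)
open import Relation.Binary.PropositionalEquality using (_≡_; _≢_)
open import Relation.Nullary using (¬_)
open import Level using (0ℓ; suc)

-- A finite simple graph whose vertex set is a subset V of Fin n
-- (so that induced subgraphs keep the same ambient vertex type).
record Graph (n : ℕ) : Set₁ where
  field
    V     : Subset n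
    E     : Fin n → Fin n → Set
    sym   : ∀ {x y} → E x y → E y x
    irrefl : ∀ {x} → ¬ E x x
open Graph public

_[_] : ∀ {n} → Graph n → Subset n → Graph n
G [ M ] = record { V = V G ∩ M ; E = E G ; sym = sym G ; irrefl = irrefl G }

_─_ : ∀ {n} → Graph n → Subset n → Graph n
G ─ M = G [ ∁ M ]

IsClique : ∀ {n} → Graph n → ℕ → Subset n → Set
IsClique G i X = X ⊆ V G × ∣ X ∣ ≡ i × (∀ {x y} → x ∈ X → y ∈ X → x ≢ y → E G x y)

IsSmallClique : ∀ {n} → Graph n → ℕ → Subset n → Set
IsSmallClique G r X = Σ ℕ λ i → i < r × IsClique G i X

Meets : ∀ {n} → Subset n → Subset n → Set
Meets S X = ∃ λ v → v ∈ S × v ∈ X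

ValidInstance : ∀ {n} → ℕ → Graph n → List (Subset n) → ℤ → Set
ValidInstance r G 𝒟 k = All (IsSmallClique G r) 𝒟

IsSolution : ∀ {n} → ℕ → Graph n → List (Subset n) → ℤ → Subset n → Set
IsSolution r G 𝒟 k S =
  S ⊆ V G × (+ ∣ S ∣) ≤ℤ k
  × (∀ X → IsClique G r X → Meets S X)
  × All (Meets S) 𝒟

Positive : ∀ {n} → ℕ → Graph n → List (Subset n) → ℤ → Set
Positive r G 𝒟 k = ∃ λ S → IsSolution r G 𝒟 k S

IsKrCover : ∀ {n} → ℕ → Graph n → Subset n → Set
IsKrCover r G M = M ⊆ V G × ¬ (∃ λ X → IsClique (G ─ M) r X)

IsContext : ∀ {n} → ℕ → Graph n → List (Subset n) → ℤ → Subset n → Set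
IsContext r G 𝒟 k M =
  ValidInstance r G 𝒟 k × IsKrCover r G M × All (λ D → D ⊆ M) 𝒟

IsPetal : ∀ {n} → ℕ → Graph n → Subset n → Subset n → Set
IsPetal r G X Y = Y ⊆ (V G ∩ ∁ X) × IsClique G r (X ∪ Y)

IsLush : ∀ {n} → ℕ → Graph n → List (Subset n) → Subset n → ℕ → Subset n → Set
IsLush r G 𝒟 M i X =
  IsClique (G [ M ]) i X
  × (∃ λ Y → IsPetal r G X Y × Y ⊆ ∁ M)
  × ¬ Any (λ D → D ⊆ X) 𝒟

IsStripped : ∀ {n} → ℕ → Graph n → List (Subset n) → Subset n → ℕ → Set
IsStripped r G 𝒟 M i =
  ∀ i' → 1 ≤ i' → i' < i → ∀ X → ¬ IsLush r G 𝒟 M i' X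

{-# OPTIONS --safe #-}
-- An r-clique X of G not inside M splits into X ∩ M and the petal X ∖ M ⊆ V(G) ∖ M.
-- X ∩ M is nonempty because M is a K_r-cover and is a proper subset of X, so it is
-- an i-clique of G[M] with 1 ≤ i < r; as the context is r-stripped it is not lush,
-- i.e. it contains some D ∈ 𝒟.  Hence every r-clique of G is an r-clique of G[M] or
-- contains an annotation, and a solution of (G[M], 𝒟, k) hits both.  Conversely a
-- solution S of (G, 𝒟, k) restricts to S ∩ M, since the r-cliques of G[M] and the
-- annotations all lie inside M.
module Submission where

open import Defs
open import Data.Nat using (ℕ; _<_)
open import Data.Integer using (ℤ; +≤+)
import Data.Integer.Properties as ℤ
open import Data.Fin.Subset
  using (Subset; _∈_; _∉_; _⊆_; _∩_; _∪_; ∁; ⊤; ∣_∣; Nonempty; Empty)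
open import Data.Fin.Subset.Properties
open import Data.List using (List)
open import Data.List.Relation.Unary.All using (All)
import Data.List.Relation.Unary.All as All
open import Data.List.Relation.Unary.Any using (Any; any?)
import Data.List.Relation.Unary.Any as Any
open import Data.Product using (_×_; _,_; proj₁; proj₂)
open import Data.Sum using (_⊎_; inj₁; inj₂)
open import Relation.Binary.PropositionalEquality
  using (_≡_; refl; cong; subst; module ≡-Reasoning) renaming (sym to ≡-sym)
open import Relation.Nullary using (yes; no)
open import Relation.Nullary.Decidable using (decidable-stable)

module _ {n : ℕ} where

  Nonempty⇒0<∣p∣ : {p : Subset n} → Nonempty p → 0 < ∣ p ∣
  Nonempty⇒0<∣p∣ {p} (x , x∈p) =
    subst (_< ∣ p ∣) (∣⊥∣≡0 n) (p⊂q⇒∣p∣<∣q∣ (⊥⊆ , x , x∈p , ∉⊥))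

  p∩∁q≢∅⇒∣p∩q∣<∣p∣ : (p q : Subset n) → Nonempty (p ∩ ∁ q) → ∣ p ∩ q ∣ < ∣ p ∣
  p∩∁q≢∅⇒∣p∩q∣<∣p∣ p q (x , x∈p∩∁q) = p⊂q⇒∣p∣<∣q∣ (p∩q⊆p p q , x , x∈p , x∉p∩q)
    where
    x∈p : x ∈ p
    x∈p = proj₁ (x∈p∩q⁻ p (∁ q) x∈p∩∁q)
    x∉p∩q : x ∉ p ∩ q
    x∉p∩q = λ x∈p∩q → x∈∁p⇒x∉p (proj₂ (x∈p∩q⁻ p (∁ q) x∈p∩∁q)) (proj₂ (x∈p∩q⁻ p q x∈p∩q))

  Empty-p∩q⇒p⊆∁q : {p q : Subset n} → Empty (p ∩ q) → p ⊆ ∁ q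
  Empty-p∩q⇒p⊆∁q empty x∈p = x∉p⇒x∈∁p (λ x∈q → empty (_ , x∈p∩q⁺ (x∈p , x∈q)))

  Empty-p∩∁q⇒p⊆q : {p q : Subset n} → Empty (p ∩ ∁ q) → p ⊆ q
  Empty-p∩∁q⇒p⊆q empty x∈p = x∉∁p⇒x∈p (λ x∈∁q → empty (_ , x∈p∩q⁺ (x∈p , x∈∁q)))

  p∩q∪p∩∁q≡p : (p q : Subset n) → (p ∩ q) ∪ (p ∩ ∁ q) ≡ p
  p∩q∪p∩∁q≡p p q = begin
    (p ∩ q) ∪ (p ∩ ∁ q) ≡⟨ ≡-sym (∩-distribˡ-∪ p q (∁ q)) ⟩
    p ∩ (q ∪ ∁ q)       ≡⟨ cong (p ∩_) (p∪∁p≡⊤ q) ⟩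
    p ∩ ⊤               ≡⟨ ∩-identityʳ p ⟩
    p                   ∎
    where open ≡-Reasoning

  Meets-mono : {S X Y : Subset n} → X ⊆ Y → Meets S X → Meets S Y
  Meets-mono X⊆Y (v , v∈S , v∈X) = v , v∈S , X⊆Y v∈X

  Meets-∩ : {S M D : Subset n} → D ⊆ M → Meets S D → Meets (S ∩ M) D
  Meets-∩ D⊆M (v , v∈S , v∈D) = v , x∈p∩q⁺ (v∈S , D⊆M v∈D) , v∈D

  Meets-annotated : {S X : Subset n} {𝒟 : List (Subset n)} →
    All (Meets S) 𝒟 → Any (_⊆ X) 𝒟 → Meets S X
  Meets-annotated = All.lookupWith (λ S-meets-D D⊆X → Meets-mono D⊆X S-meets-D)

module Cliques {n : ℕ} (G : Graph n) where

  clique-⊆ : {i : ℕ} {X Y : Subset n} → IsClique G i X → Y ⊆ X → IsClique G ∣ Y ∣ Y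
  clique-⊆ (X⊆V , _ , adj) Y⊆X =
    (λ y∈Y → X⊆V (Y⊆X y∈Y)) , refl , λ x∈Y y∈Y → adj (Y⊆X x∈Y) (Y⊆X y∈Y)

  clique-[]⁺ : {i : ℕ} {M X : Subset n} → IsClique G i X → X ⊆ M → IsClique (G [ M ]) i X
  clique-[]⁺ (X⊆V , ∣X∣≡i , adj) X⊆M = (λ x∈X → x∈p∩q⁺ (X⊆V x∈X , X⊆M x∈X)) , ∣X∣≡i , adj

  clique-[]⁻ : {i : ℕ} {M X : Subset n} → IsClique (G [ M ]) i X → IsClique G i X
  clique-[]⁻ {M = M} (X⊆V∩M , ∣X∣≡i , adj) =
    (λ x∈X → proj₁ (x∈p∩q⁻ (V G) M (X⊆V∩M x∈X))) , ∣X∣≡i , adj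

  clique-[]-⊆ : {i : ℕ} {M X : Subset n} → IsClique (G [ M ]) i X → X ⊆ M
  clique-[]-⊆ {M = M} (X⊆V∩M , _) x∈X = proj₂ (x∈p∩q⁻ (V G) M (X⊆V∩M x∈X))

  split-petal : {r : ℕ} {X : Subset n} (M : Subset n) →
    IsClique G r X → IsPetal r G (X ∩ M) (X ∩ ∁ M)
  split-petal {r} {X} M X-clique@(X⊆V , _) =
    outside , subst (IsClique G r) (≡-sym (p∩q∪p∩∁q≡p X M)) X-clique
    where
    outside : X ∩ ∁ M ⊆ V G ∩ ∁ (X ∩ M)
    outside x∈X∩∁M =
      let (x∈X , x∈∁M) = x∈p∩q⁻ X (∁ M) x∈X∩∁M
      in x∈p∩q⁺ (X⊆V x∈X , x∉p⇒x∈∁p (λ x∈X∩M → x∈∁p⇒x∉p x∈∁M (proj₂ (x∈p∩q⁻ X M x∈X∩M))))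

module Restriction {n : ℕ} (r : ℕ) (G : Graph n) (𝒟 : List (Subset n)) (M : Subset n) where

  open Cliques G

  stripped⇒annotated : {X : Subset n} → IsStripped r G 𝒟 M r → IsClique G r X →
    Nonempty (X ∩ M) → Nonempty (X ∩ ∁ M) → Any (_⊆ X ∩ M) 𝒟
  stripped⇒annotated {X} stripped X-clique@(_ , ∣X∣≡r , _) X∩M≢∅ X∖M≢∅ =
    decidable-stable (any? (_⊆? X ∩ M) 𝒟) λ not-annotated →
      stripped ∣ X ∩ M ∣ (Nonempty⇒0<∣p∣ X∩M≢∅) ∣X∩M∣<r (X ∩ M)
        ( clique-[]⁺ (clique-⊆ X-clique (p∩q⊆p X M)) (p∩q⊆q X M)
        , (X ∩ ∁ M , split-petal M X-clique , p∩q⊆q X (∁ M))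
        , not-annotated )
    where
    ∣X∩M∣<r : ∣ X ∩ M ∣ < r
    ∣X∩M∣<r = subst (∣ X ∩ M ∣ <_) ∣X∣≡r (p∩∁q≢∅⇒∣p∩q∣<∣p∣ X M X∖M≢∅)

  clique-inside-or-annotated : {X : Subset n} → IsKrCover r G M → IsStripped r G 𝒟 M r →
    IsClique G r X → IsClique (G [ M ]) r X ⊎ Any (_⊆ X) 𝒟
  clique-inside-or-annotated {X} (_ , no-clique-outside) stripped X-clique
    with nonempty? (X ∩ ∁ M)
  ... | no X∖M≡∅ = inj₁ (clique-[]⁺ X-clique (Empty-p∩∁q⇒p⊆q X∖M≡∅))
  ... | yes X∖M≢∅ = inj₂ (Any.map (λ D⊆X∩M {_} x∈D → p∩q⊆p X M (D⊆X∩M x∈D))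
                                  (stripped⇒annotated stripped X-clique X∩M≢∅ X∖M≢∅))
    where
    X∩M≢∅ : Nonempty (X ∩ M)
    X∩M≢∅ = decidable-stable (nonempty? (X ∩ M)) λ X∩M≡∅ →
      no-clique-outside (X , clique-[]⁺ X-clique (Empty-p∩q⇒p⊆∁q X∩M≡∅))

  restrict-solution : {k : ℤ} {S : Subset n} → All (_⊆ M) 𝒟 →
    IsSolution r G 𝒟 k S → IsSolution r (G [ M ]) 𝒟 k (S ∩ M)
  restrict-solution {S = S} 𝒟⊆M (S⊆V , ∣S∣≤k , hits-cliques , hits-𝒟) =
      (λ x∈S∩M → let (x∈S , x∈M) = x∈p∩q⁻ S M x∈S∩M in x∈p∩q⁺ (S⊆V x∈S , x∈M))
    , ℤ.≤-trans (+≤+ (∣p∩q∣≤∣p∣ S M)) ∣S∣≤k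
    , (λ X X-clique → Meets-∩ (clique-[]-⊆ X-clique) (hits-cliques X (clique-[]⁻ X-clique)))
    , All.zipWith {P = _⊆ M} (λ (D⊆M , S-meets-D) → Meets-∩ D⊆M S-meets-D) (𝒟⊆M , hits-𝒟)

  lift-solution : {k : ℤ} {S : Subset n} →
    (∀ {X} → IsClique G r X → IsClique (G [ M ]) r X ⊎ Any (_⊆ X) 𝒟) →
    IsSolution r (G [ M ]) 𝒟 k S → IsSolution r G 𝒟 k S
  lift-solution {S = S} dichotomy (S⊆V∩M , ∣S∣≤k , hits-cliques , hits-𝒟) =
      (λ x∈S → proj₁ (x∈p∩q⁻ (V G) M (S⊆V∩M x∈S)))
    , ∣S∣≤k
    , (λ X X-clique → hits X (dichotomy X-clique))
    , hits-𝒟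
    where
    hits : ∀ X → IsClique (G [ M ]) r X ⊎ Any (_⊆ X) 𝒟 → Meets S X
    hits X (inj₁ X-clique) = hits-cliques X X-clique
    hits X (inj₂ annotated) = Meets-annotated hits-𝒟 annotated

lemma4p1 : (r n : ℕ) (G : Graph n) (𝒟 : List (Subset n)) (k : ℤ) (M : Subset n)
    → IsContext r G 𝒟 k M
    → IsStripped r G 𝒟 M r
    → (Positive r G 𝒟 k → Positive r (G [ M ]) 𝒟 k)
      × (Positive r (G [ M ]) 𝒟 k → Positive r G 𝒟 k)
lemma4p1 r n G 𝒟 k M (_ , cover , 𝒟⊆M) stripped =
    (λ (S , S-solves) → S ∩ M , restrict-solution 𝒟⊆M S-solves)
  , (λ (S , S-solves) → S , lift-solution (clique-inside-or-annotated cover stripped) S-solves)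
  where open Restriction r G 𝒟 M
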